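{- Let $d\in\mathcal{D}_\Box$ and $\delta_L,\delta_R\in\mathcal{D}_\Box^*$. Then $\mathcal{T}_{E_T^\infty}(T_{\delta_L\check d\delta_R})\leftrightarrow_b^\Delta\mathcal{T}_{E_T\cup E_Q^\infty}([H_d\parallel Q_{\delta_R\bot\delta_L}]_{\{i,o\}})$.
   Context: Process calculus. Fix a finite set $\mathcal{A}$ of actions, $\tau\notin\mathcal{A}$, a finite data set $\mathcal{D}$ with blank $\Box\notin\mathcal{D}$, $\mathcal{D}_\Box=\mathcal{D}\cup\{\Box\}$, extra symbols $\bot,\$\notin\mathcal{D}_\Box$, and channels including $i,o,r,w,m$. For a set $C'$ of channels, $I_{C'}=\{c?v,c!v\mid c\in C'\}$, $v$ ranging over communicated values (including $\mathcal{D}_\Box$, $L$, $R$, $\bot$, $\$$). Process expressions: $p::=0\mid 1\mid a.p\mid p+p\mid[p\parallel p]_{C'}\mid X$. A recursive specification $E$ is a set of equations $X\stackrel{def}{=}p$, at most one per name, with defining equations for all names used. Rules ($p\downarrow$ = termination): $1\downarrow$; $a.p\xrightarrow{a}p$; $p+q$ has the transitions of $p$ and $q$ and terminates if either does; $[p\parallel q]_{C'}\xrightarrow{a}[p'\parallel q]_{C'}$ if $p\xrightarrow{a}p'$, $a\notin I_{C'}$, and symmetrically; $[p\parallel q]_{C'}\xrightarrow{\tau}[p'\parallel q']_{C'}$ if for some $c\in C'$ and $v$, $p\xrightarrow{c?v}p'$, $q\xrightarrow{c!v}q'$ or vice versa; $[p\parallel q]_{C'}\downarrow$ iff both terminate;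 names behave as their defining right-hand sides. $\mathcal{T}_E(p)$: expressions reachable from $p$, initial $p$, final those $q$ with $q\downarrow$. Tape instances: finite sequences over $\mathcal{D}_\Box$ and marked symbols $\check d$ with exactly one marked symbol, identified modulo blanks at the ends; for $\delta\in\mathcal{D}_\Box^*$, $\overleftarrow{\delta}$ (resp. $\overrightarrow{\delta}$) marks its rightmost (resp. leftmost) symbol, or is $\check\Box$ if $\delta$ is empty. $E_T^\infty$: for all $d,\delta_L,\delta_R$: $T_{\delta_L\check d\delta_R}\stackrel{def}{=}r!d.T_{\delta_L\check d\delta_R}+\sum_{e\in\mathcal{D}_\Box}w?e.T_{\delta_L\check e\delta_R}+m?L.T_{\overleftarrow{\delta_L}d\delta_R}+m?R.T_{\delta_Ld\overrightarrow{\delta_R}}+1$. Queue $E_Q^\infty$ (over $\Delta=\mathcal{D}_\Box\cup\{\bot,\$\}$): $Q_\varepsilon\stackrel{def}{=}\sum_{x\in\Delta}i?x.Q_x+1$, $Q_{\sigma x}\stackrel{def}{=}o!x.Q_\sigma+\sum_{y\in\Delta}i?y.Q_{y\sigma x}+1$. Controller $E_T$: $H_d\stackrel{def}{=}r!d.H_d+\sum_{e\in\mathcal{D}_\Box}w?e.H_e+m?L.H^L_d+m?R.H^R_d+1$; $H^L_d\stackrel{def}{=}i!d.(\sum_{e\in\mathcal{D}_\Box}o?e.H_e+o?\bot.i!\$.i!\bot.\mathit{Back})$; $\mathit{Back}\stackrel{def}{=}\sum_{e\in\mathcal{D}_\Box}o?e.i!e.\mathit{Back}+o?\$.H_\Box$;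 $H^R_d\stackrel{def}{=}i!\$.i!d.(\sum_{e\in\mathcal{D}_\Box}o?e.\mathit{Fwd}_e+o?\bot.\mathit{Fwd}_\bot)$; $\mathit{Fwd}_d\stackrel{def}{=}\sum_{e\in\mathcal{D}_\Box}o?e.i!d.\mathit{Fwd}_e+o?\bot.i!d.\mathit{Fwd}_\bot+o?\$.H_d$; $\mathit{Fwd}_\bot\stackrel{def}{=}\sum_{e\in\mathcal{D}_\Box}o?e.i!\bot.\mathit{Fwd}_e+o?\$.i!\bot.H_\Box$. Divergence-preserving branching bisimilarity $\leftrightarrow_b^\Delta$: write $s\xrightarrow{(a)}t$ if $s\xrightarrow{a}t$ or ($a=\tau$ and $s=t$); $\twoheadrightarrow$ / $\twoheadrightarrow^+$ are reflexive-transitive / transitive closures of $\xrightarrow{\tau}$. A relation $\mathcal{R}$ is a divergence-preserving branching bisimulation if $s_1\mathcal{R}s_2$ implies: (1) $s_1\xrightarrow{a}s_1'$ gives $s_2\twoheadrightarrow s_2''\xrightarrow{(a)}s_2'$ with $s_1\mathcal{R}s_2''$, $s_1'\mathcal{R}s_2'$; (2) symmetrically; (3) if $s_1$ final then $s_2\twoheadrightarrow s_2'$ final with $s_1\mathcal{R}s_2'$; (4) symmetrically; (5) an infinite $\tau$-sequence from $s_1$ with all states related to $s_2$ gives $s_2\twoheadrightarrow^+s_2'$ with $s_2'$ related to some state of the sequence; (6) symmetrically. Two transition systems are $\leftrightarrow_b^\Delta$ if such a relation relates their initial states. -}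

module Defs where

open import Data.Nat using (ℕ; zero; suc)
open import Data.Fin using (Fin)
open import Data.List using (List; []; _∷_; map; _++_; reverse; _∷ʳ_; allFin)
open import Data.List.Membership.Propositional using (_∈_)
open import Data.Maybe using (Maybe; just; nothing)
open import Data.Product using (Σ; ∃; ∃-syntax; _×_; _,_)
open import Data.Sum using (_⊎_; inj₁; inj₂)
open import Relation.Nullary using (¬_)
open import Relation.Binary.PropositionalEquality using (_≡_)
open import Function using (flip)

variable
  A : Set
  n : ℕ
  N M : Set

-- D = Fin n (a finite data set); DB n = D_□ = D ∪ {□}
data DB (n : ℕ) : Set where
  □   : DB n
  dat : Fin n → DB n

allDB : (n : ℕ) → List (DB n)
allDB n = □ ∷ map dat (allFin n)

-- Δ = D_□ ∪ {⊥, $}   (queue symbols)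
data Sym (n : ℕ) : Set where
  sd : DB n → Sym n
  s⊥ : Sym n
  s$ : Sym n

allSym : (n : ℕ) → List (Sym n)
allSym n = map sd (allDB n) ++ (s⊥ ∷ s$ ∷ [])

data Val (n : ℕ) : Set where
  vd : DB n → Val n
  vL vR v⊥ v$ : Val n

symVal : Sym n → Val n
symVal (sd d) = vd d
symVal s⊥ = v⊥
symVal s$ = v$

data Chan : Set where
  i o r w m : Chan

-- actions: τ, elements of the finite action set A, c?v (⁇) and c!v (‼)
data Act (A : Set) (n : ℕ) : Set where
  τ   : Act A n
  act : A → Act A n
  _⁇_ : Chan → Val n → Act A n
  _‼_ : Chan → Val n → Act A n

InI : List Chan → Act A n → Set
InI {A} {n} C a = ∃[ c ] (c ∈ C × ∃[ v ] (a ≡ c ⁇ v ⊎ a ≡ c ‼ v))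

infixr 6 _⊕_
infixr 7 _∙_

data Proc (A : Set) (n : ℕ) (N : Set) : Set where
  𝟘 𝟙   : Proc A n N
  _∙_   : Act A n → Proc A n N → Proc A n N
  _⊕_   : Proc A n N → Proc A n N → Proc A n N
  ⟦_∥_⟧_ : Proc A n N → Proc A n N → List Chan → Proc A n N
  var   : N → Proc A n N

rename : (N → M) → Proc A n N → Proc A n M
rename f 𝟘 = 𝟘
rename f 𝟙 = 𝟙
rename f (a ∙ p) = a ∙ rename f p
rename f (p ⊕ q) = rename f p ⊕ rename f q
rename f (⟦ p ∥ q ⟧ C) = ⟦ rename f p ∥ rename f q ⟧ C
rename f (var X) = var (f X)

sumP : {X : Set} → List X → (X → Proc A n N) → Proc A n N
sumP [] f = 𝟘
sumP (x ∷ []) f = f x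
sumP (x ∷ y ∷ xs) f = f x ⊕ sumP (y ∷ xs) f

Spec : Set → ℕ → Set → Set
Spec A n N = N → Proc A n N

data _⊢_⟶[_]_ (E : Spec A n N) : Proc A n N → Act A n → Proc A n N → Set where
  pre   : ∀ {a p} → E ⊢ (a ∙ p) ⟶[ a ] p
  sumˡ  : ∀ {p q a p'} → E ⊢ p ⟶[ a ] p' → E ⊢ (p ⊕ q) ⟶[ a ] p'
  sumʳ  : ∀ {p q a q'} → E ⊢ q ⟶[ a ] q' → E ⊢ (p ⊕ q) ⟶[ a ] q'
  parˡ  : ∀ {p q a p' C} → E ⊢ p ⟶[ a ] p' → ¬ InI C a →
          E ⊢ (⟦ p ∥ q ⟧ C) ⟶[ a ] (⟦ p' ∥ q ⟧ C)
  parʳ  : ∀ {p q a q' C} → E ⊢ q ⟶[ a ] q' → ¬ InI C a →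
          E ⊢ (⟦ p ∥ q ⟧ C) ⟶[ a ] (⟦ p ∥ q' ⟧ C)
  comm₁ : ∀ {p q p' q' C c v} → c ∈ C →
          E ⊢ p ⟶[ c ⁇ v ] p' → E ⊢ q ⟶[ c ‼ v ] q' →
          E ⊢ (⟦ p ∥ q ⟧ C) ⟶[ τ ] (⟦ p' ∥ q' ⟧ C)
  comm₂ : ∀ {p q p' q' C c v} → c ∈ C →
          E ⊢ p ⟶[ c ‼ v ] p' → E ⊢ q ⟶[ c ⁇ v ] q' →
          E ⊢ (⟦ p ∥ q ⟧ C) ⟶[ τ ] (⟦ p' ∥ q' ⟧ C)
  rec   : ∀ {X a p'} → E ⊢ E X ⟶[ a ] p' → E ⊢ var X ⟶[ a ] p'

data _⊢_↓ (E : Spec A n N) : Proc A n N → Set where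
  one  : E ⊢ 𝟙 ↓
  sumˡ : ∀ {p q} → E ⊢ p ↓ → E ⊢ (p ⊕ q) ↓
  sumʳ : ∀ {p q} → E ⊢ q ↓ → E ⊢ (p ⊕ q) ↓
  par  : ∀ {p q C} → E ⊢ p ↓ → E ⊢ q ↓ → E ⊢ (⟦ p ∥ q ⟧ C) ↓
  rec  : ∀ {X} → E ⊢ E X ↓ → E ⊢ var X ↓

data Reachable (E : Spec A n N) (p : Proc A n N) : Proc A n N → Set where
  here : Reachable E p p
  step : ∀ {q a q'} → Reachable E p q → E ⊢ q ⟶[ a ] q' → Reachable E p q'

record LTS (A : Set) (n : ℕ) : Set₁ where
  field
    State : Set
    _⟶⟨_⟩_ : State → Act A n → State → Set
    Final : State → Set
    init  : State
open LTS public

𝒯 : Spec A n N → Proc A n N → LTS A n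
𝒯 {A} {n} {N} E p = record
  { State  = Σ (Proc A n N) (Reachable E p)
  ; _⟶⟨_⟩_ = λ { (q , _) a (q' , _) → E ⊢ q ⟶[ a ] q' }
  ; Final  = λ { (q , _) → E ⊢ q ↓ }
  ; init   = p , here
  }

module _ (S : LTS A n) where
  Step : State S → Act A n → State S → Set
  Step = _⟶⟨_⟩_ S

  data _↠_ : State S → State S → Set where
    ↠-refl : ∀ {s} → s ↠ s
    ↠-step : ∀ {s t u} → Step s τ t → t ↠ u → s ↠ u

  _↠⁺_ : State S → State S → Set
  s ↠⁺ u = ∃[ t ] (Step s τ t × t ↠ u)

  StepOpt : State S → Act A n → State S → Set
  StepOpt s a t = Step s a t ⊎ (a ≡ τ × s ≡ t)

-- conditions (1), (3), (5); the symmetric ones are obtained by flipping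
HalfDPBB : (S₁ S₂ : LTS A n) → (State S₁ → State S₂ → Set) → Set
HalfDPBB S₁ S₂ R =
  (∀ {s₁ s₂ a s₁'} → R s₁ s₂ → Step S₁ s₁ a s₁' →
     ∃[ s₂'' ] ∃[ s₂' ] (_↠_ S₂ s₂ s₂'' × StepOpt S₂ s₂'' a s₂' × R s₁ s₂'' × R s₁' s₂'))
  × (∀ {s₁ s₂} → R s₁ s₂ → Final S₁ s₁ →
     ∃[ s₂' ] (_↠_ S₂ s₂ s₂' × Final S₂ s₂' × R s₁ s₂'))
  × (∀ {s₁ s₂} (f : ℕ → State S₁) → f zero ≡ s₁ →
     (∀ k → Step S₁ (f k) τ (f (suc k))) → (∀ k → R (f k) s₂) →
     ∃[ s₂' ] ∃[ k ] (_↠⁺_ S₂ s₂ s₂' × R (f k) s₂'))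

IsDPBB : (S₁ S₂ : LTS A n) → (State S₁ → State S₂ → Set) → Set
IsDPBB S₁ S₂ R = HalfDPBB S₁ S₂ R × HalfDPBB S₂ S₁ (flip R)

_≈Δ_ : LTS A n → LTS A n → Set₁
S₁ ≈Δ S₂ = Σ (State S₁ → State S₂ → Set) λ R → IsDPBB S₁ S₂ R × R (init S₁) (init S₂)

unsnoc : {X : Set} → List X → Maybe (List X × X)
unsnoc [] = nothing
unsnoc (x ∷ xs) with unsnoc xs
... | nothing = just ([] , x)
... | just (ys , y) = just (x ∷ ys , y)

-- Tapes: δL ď δR as a triple, normalised modulo blanks at the ends

TapeName : ℕ → Set
TapeName n = List (DB n) × DB n × List (DB n)

stripL : List (DB n) → List (DB n)
stripL [] = []
stripL (□ ∷ xs) = stripL xs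
stripL (dat d ∷ xs) = dat d ∷ xs

stripR : List (DB n) → List (DB n)
stripR xs = reverse (stripL (reverse xs))

tape : List (DB n) → DB n → List (DB n) → TapeName n
tape δl d δr = stripL δl , d , stripR δr

moveL : TapeName n → TapeName n
moveL (δl , d , δr) with unsnoc δl
... | nothing = tape [] □ (d ∷ δr)
... | just (δl' , e) = tape δl' e (d ∷ δr)

moveR : TapeName n → TapeName n
moveR (δl , d , []) = tape (δl ∷ʳ d) □ []
moveR (δl , d , e ∷ δr) = tape (δl ∷ʳ d) e δr

E-T∞ : Spec A n (TapeName n)
E-T∞ {n = n} (δl , d , δr) =
  (r ‼ vd d) ∙ var (tape δl d δr)
  ⊕ sumP (allDB n) (λ e → (w ⁇ vd e) ∙ var (tape δl e δr))
  ⊕ (m ⁇ vL) ∙ var (moveL (δl , d , δr))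
  ⊕ (m ⁇ vR) ∙ var (moveR (δl , d , δr))
  ⊕ 𝟙

E-Q∞ : Spec A n (List (Sym n))
E-Q∞ {n = n} σ with unsnoc σ
... | nothing = sumP (allSym n) (λ x → (i ⁇ symVal x) ∙ var (x ∷ [])) ⊕ 𝟙
... | just (σ' , x) =
  (o ‼ symVal x) ∙ var σ'
  ⊕ sumP (allSym n) (λ y → (i ⁇ symVal y) ∙ var (y ∷ σ))
  ⊕ 𝟙

data CName (n : ℕ) : Set where
  H HL HR : DB n → CName n
  Back    : CName n
  Fwd     : DB n → CName n
  Fwd⊥    : CName n

E-T : Spec A n (CName n)
E-T {n = n} (H d) =
  (r ‼ vd d) ∙ var (H d)
  ⊕ sumP (allDB n) (λ e → (w ⁇ vd e) ∙ var (H e))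
  ⊕ (m ⁇ vL) ∙ var (HL d)
  ⊕ (m ⁇ vR) ∙ var (HR d)
  ⊕ 𝟙
E-T {n = n} (HL d) =
  (i ‼ vd d) ∙
    ( sumP (allDB n) (λ e → (o ⁇ vd e) ∙ var (H e))
    ⊕ (o ⁇ v⊥) ∙ (i ‼ v$) ∙ (i ‼ v⊥) ∙ var Back)
E-T {n = n} Back =
  sumP (allDB n) (λ e → (o ⁇ vd e) ∙ (i ‼ vd e) ∙ var Back)
  ⊕ (o ⁇ v$) ∙ var (H □)
E-T {n = n} (HR d) =
  (i ‼ v$) ∙ (i ‼ vd d) ∙
    ( sumP (allDB n) (λ e → (o ⁇ vd e) ∙ var (Fwd e))
    ⊕ (o ⁇ v⊥) ∙ var Fwd⊥)
E-T {n = n} (Fwd d) =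
  sumP (allDB n) (λ e → (o ⁇ vd e) ∙ (i ‼ vd d) ∙ var (Fwd e))
  ⊕ (o ⁇ v⊥) ∙ (i ‼ vd d) ∙ var Fwd⊥
  ⊕ (o ⁇ v$) ∙ var (H d)
E-T {n = n} Fwd⊥ =
  sumP (allDB n) (λ e → (o ⁇ vd e) ∙ (i ‼ v⊥) ∙ var (Fwd e))
  ⊕ (o ⁇ v$) ∙ (i ‼ v⊥) ∙ var (H □)

E-TQ : Spec A n (CName n ⊎ List (Sym n))
E-TQ (inj₁ X) = rename inj₁ (E-T X)
E-TQ (inj₂ σ) = rename inj₂ (E-Q∞ σ)

qword : List (DB n) → List (DB n) → List (Sym n)
qword δL δR = map sd δR ++ s⊥ ∷ map sd δL

system : DB n → List (DB n) → List (DB n) → Proc A n (CName n ⊎ List (Sym n))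
system d δL δR = ⟦ var (inj₁ (H d)) ∥ var (inj₂ (qword δL δR)) ⟧ (i ∷ o ∷ [])

module Submission where

-- Every configuration of the system [p ∥ Q_σ]_{i,o} represents a tape:
-- the idle configuration [H_d ∥ Q_{δR⊥δL}] represents δL ď δR, and every
-- configuration reached while the controller carries out a move m?L or m?R
-- already represents the moved tape.  Idle configurations perform exactly the
-- visible steps of their tape.  Every other configuration has exactly one
-- step, an exchange with the queue that keeps the represented tape and
-- decreases a natural-number measure (the work left in the queue rotation);
-- such inert steps can neither be observed nor diverge.

open import Defs
open import Data.Nat using (ℕ; zero; suc; _+_; _<_; z<s)
open import Data.Nat.Properties using (≤-refl; ≤-reflexive)
open import Data.Nat.Induction using (<-wellFounded)
open import Induction.WellFounded using (Acc; acc)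
open import Data.Fin using (Fin)
open import Data.List using (List; []; _∷_; map; _++_; _∷ʳ_; reverse; [_]; InitLast; initLast; _∷ʳ′_)
open import Data.List.Properties using (++-assoc; ++-identityʳ; map-++; map-∘; ∷ʳ-injective; ∷ʳ-++; ∷-injective; reverse-involutive; reverse-++; unfold-reverse)
open import Data.List.Membership.Propositional using (_∈_)
open import Data.List.Membership.Propositional.Properties using (∈-map⁺; ∈-allFin; ∈-++⁺ˡ; ∈-++⁺ʳ)
open import Data.List.Relation.Unary.Any using (here; there)
open import Data.Maybe using (just; nothing)
open import Data.Product using (Σ; ∃-syntax; _×_; _,_; proj₁; proj₂)
open import Data.Sum using (_⊎_; inj₁; inj₂; map₂)
open import Data.Empty using (⊥; ⊥-elim)
open import Relation.Nullary using (¬_)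
open import Relation.Binary.PropositionalEquality using (_≡_; _≢_; refl; sym; trans; cong; subst; module ≡-Reasoning)
open import Relation.Binary.Construct.Closure.ReflexiveTransitive using (Star; ε; _◅_)
open import Function using (flip; _∘_)

module _ {A N : Set} {n : ℕ} {E : Spec A n N} {X : Set} where

  sumP-inv : (xs : List X) (f : X → Proc A n N) {a : Act A n} {q : Proc A n N} →
    E ⊢ sumP xs f ⟶[ a ] q → ∃[ x ] (x ∈ xs × E ⊢ f x ⟶[ a ] q)
  sumP-inv (x ∷ []) f h = x , here refl , h
  sumP-inv (x ∷ y ∷ xs) f (sumˡ h) = x , here refl , h
  sumP-inv (x ∷ y ∷ xs) f (sumʳ h) with sumP-inv (y ∷ xs) f h
  ... | z , z∈ , h' = z , there z∈ , h'

  sumP-in : (xs : List X) (f : X → Proc A n N) {x : X} {a : Act A n} {q : Proc A n N} →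
    x ∈ xs → E ⊢ f x ⟶[ a ] q → E ⊢ sumP xs f ⟶[ a ] q
  sumP-in (x ∷ []) f (here refl) h = h
  sumP-in (x ∷ y ∷ xs) f (here refl) h = sumˡ h
  sumP-in (x ∷ y ∷ xs) f (there x∈) h = sumʳ (sumP-in (y ∷ xs) f x∈ h)

rename-sumP : ∀ {A N M X : Set} {n : ℕ} (g : N → M) (xs : List X) (f : X → Proc A n N) →
  rename g (sumP xs f) ≡ sumP xs (rename g ∘ f)
rename-sumP g [] f = refl
rename-sumP g (x ∷ []) f = refl
rename-sumP g (x ∷ y ∷ xs) f = cong (rename g (f x) ⊕_) (rename-sumP g (y ∷ xs) f)

module _ {A N M X : Set} {n : ℕ} {E : Spec A n M} (g : N → M) (xs : List X) (f : X → Proc A n N) where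

  rename-sumP-inv : ∀ {a q} → E ⊢ rename g (sumP xs f) ⟶[ a ] q → ∃[ x ] (x ∈ xs × E ⊢ rename g (f x) ⟶[ a ] q)
  rename-sumP-inv h = sumP-inv xs (rename g ∘ f) (subst (λ p → E ⊢ p ⟶[ _ ] _) (rename-sumP g xs f) h)

  rename-sumP-in : ∀ {x a q} → x ∈ xs → E ⊢ rename g (f x) ⟶[ a ] q → E ⊢ rename g (sumP xs f) ⟶[ a ] q
  rename-sumP-in x∈ h = subst (λ p → E ⊢ p ⟶[ _ ] _) (sym (rename-sumP g xs f)) (sumP-in xs (rename g ∘ f) x∈ h)

∈-allDB : ∀ {n} (d : DB n) → d ∈ allDB n
∈-allDB □ = here refl
∈-allDB (dat k) = there (∈-map⁺ dat (∈-allFin k))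

∈-allSym : ∀ {n} (y : Sym n) → y ∈ allSym n
∈-allSym (sd d) = ∈-++⁺ˡ (∈-map⁺ sd (∈-allDB d))
∈-allSym {n} s⊥ = ∈-++⁺ʳ (map sd (allDB n)) (here refl)
∈-allSym {n} s$ = ∈-++⁺ʳ (map sd (allDB n)) (there (here refl))

_⊢_⟶τ*_ : ∀ {A N : Set} {n : ℕ} → Spec A n N → Proc A n N → Proc A n N → Set
E ⊢ p ⟶τ* q = Star (λ s t → E ⊢ s ⟶[ τ ] t) p q

lift-τ* : ∀ {A N : Set} {n : ℕ} {E : Spec A n N} {p₀ p q : Proc A n N} (ρ : Reachable E p₀ p) →
  E ⊢ p ⟶τ* q → Σ (Reachable E p₀ q) λ ρ' → _↠_ (𝒯 E p₀) (p , ρ) (q , ρ')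
lift-τ* ρ ε = ρ , ↠-refl
lift-τ* ρ (h ◅ path) with lift-τ* (step ρ h) path
... | ρ' , chain = ρ' , ↠-step h chain

-- Configurations c describe both an abstract
-- expression abs c over E₁ and a concrete one emb c over E₂.  Suppose stable
-- configurations perform, on both sides, exactly the Visible steps (none of
-- them τ), and every other concrete step is an inert τ-step: it keeps the
-- abstract expression and decreases the measure μ.  Then abs c and emb c are
-- divergence-preserving branching bisimilar, via the relation of all pairs
-- (abs c , emb c).
module Abstraction {A N₁ N₂ Cfg : Set} {n : ℕ} (E₁ : Spec A n N₁) (E₂ : Spec A n N₂)
  (abs : Cfg → Proc A n N₁) (emb : Cfg → Proc A n N₂) (μ : Cfg → ℕ)
  (Stable : Cfg → Set) (Visible : Cfg → Act A n → Cfg → Set) where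

  data Inert (c : Cfg) (q : Proc A n N₂) : Set where
    inert : ∀ c' → q ≡ emb c' → abs c' ≡ abs c → μ c' < μ c → Inert c q

  record IsRefinement : Set where
    field
      visible-abs   : ∀ {c a c'} → Visible c a c' → E₁ ⊢ abs c ⟶[ a ] abs c'
      visible-emb   : ∀ {c a c'} → Visible c a c' → E₂ ⊢ emb c ⟶[ a ] emb c'
      visible-not-τ : ∀ {c c'} → ¬ Visible c τ c'
      abs-steps     : ∀ {c a q} → Stable c → E₁ ⊢ abs c ⟶[ a ] q → ∃[ c' ] (Visible c a c' × q ≡ abs c')
      emb-steps     : ∀ {c a q} → E₂ ⊢ emb c ⟶[ a ] q →
                      (∃[ c' ] (Visible c a c' × q ≡ emb c')) ⊎ (a ≡ τ × Inert c q)
      progress      : ∀ c → Stable c ⊎ ∃[ q ] (E₂ ⊢ emb c ⟶[ τ ] q × Inert c q)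
      abs-final     : ∀ {c} → E₂ ⊢ emb c ↓ → E₁ ⊢ abs c ↓
      emb-final     : ∀ {c} → Stable c → E₁ ⊢ abs c ↓ → E₂ ⊢ emb c ↓

  module _ (ref : IsRefinement) where
    open IsRefinement ref

    settle : ∀ c → Acc _<_ (μ c) → ∃[ c* ] (Stable c* × E₂ ⊢ emb c ⟶τ* emb c* × abs c* ≡ abs c)
    settle c (acc smaller) with progress c
    ... | inj₁ stable = c , stable , ε , refl
    ... | inj₂ (_ , h , inert c' refl same lt) with settle c' (smaller lt)
    ...   | c* , stable , path , same' = c* , stable , h ◅ path , trans same' same

    -- no infinite τ-run starts in an embedded configuration, since inert steps decrease μ
    no-divergence : ∀ c → Acc _<_ (μ c) → (f : ℕ → Proc A n N₂) → f zero ≡ emb c →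
      (∀ k → E₂ ⊢ f k ⟶[ τ ] f (suc k)) → ⊥
    no-divergence c (acc smaller) f start run
      with emb-steps (subst (λ p → E₂ ⊢ p ⟶[ τ ] f 1) start (run zero))
    ... | inj₁ (_ , visible , _) = visible-not-τ visible
    ... | inj₂ (_ , inert c' next _ lt) =
      no-divergence c' (smaller lt) (f ∘ suc) next (run ∘ suc)

    -- abstract expressions have no τ-steps: a stable configuration with the
    -- same abstraction would have to match it by a visible τ-step
    abs-no-τ : ∀ c {q} → ¬ E₁ ⊢ abs c ⟶[ τ ] q
    abs-no-τ c h with settle c (<-wellFounded (μ c))
    ... | c* , stable , _ , same with abs-steps stable (subst (λ p → E₁ ⊢ p ⟶[ τ ] _) (sym same) h)
    ...   | _ , visible , _ = visible-not-τ visible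

    module _ (c₀ : Cfg) where
      private
        S₁ S₂ : LTS A n
        S₁ = 𝒯 E₁ (abs c₀)
        S₂ = 𝒯 E₂ (emb c₀)

      Rel : State S₁ → State S₂ → Set
      Rel (p , _) (q , _) = ∃[ c ] (p ≡ abs c × q ≡ emb c)

      -- an abstract step is matched after settling the concrete side into a
      -- stable configuration; abstract τ-runs do not exist
      abstract-half : HalfDPBB S₁ S₂ Rel
      abstract-half = (λ {s₁} {s₂} {a} {s₁'} → transfer {s₁} {s₂} {a} {s₁'}) ,
                      (λ {s₁} {s₂} → termination {s₁} {s₂}) ,
                      (λ {s₁} {s₂} → divergence {s₁} {s₂})
        where
          transfer : ∀ {s₁ s₂ a s₁'} → Rel s₁ s₂ → Step S₁ s₁ a s₁' →
            ∃[ s₂'' ] ∃[ s₂' ] (_↠_ S₂ s₂ s₂'' × StepOpt S₂ s₂'' a s₂' × Rel s₁ s₂'' × Rel s₁' s₂')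
          transfer {_ , _} {_ , ρ} {a} {p' , _} (c , refl , refl) h with settle c (<-wellFounded (μ c))
          ... | c* , stable , path , same with lift-τ* ρ path
                                              | abs-steps stable (subst (λ p → E₁ ⊢ p ⟶[ a ] p') (sym same) h)
          ... | ρ* , chain | c' , visible , refl =
            (emb c* , ρ*) , (emb c' , step ρ* (visible-emb visible)) , chain , inj₁ (visible-emb visible) ,
            (c* , sym same , refl) , (c' , refl , refl)

          termination : ∀ {s₁ s₂} → Rel s₁ s₂ → Final S₁ s₁ → ∃[ s₂' ] (_↠_ S₂ s₂ s₂' × Final S₂ s₂' × Rel s₁ s₂')
          termination {_ , _} {_ , ρ} (c , refl , refl) final with settle c (<-wellFounded (μ c))
          ... | c* , stable , path , same with lift-τ* ρ path
          ... | ρ* , chain = (emb c* , ρ*) , chain ,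
            emb-final stable (subst (E₁ ⊢_↓) (sym same) final) , (c* , sym same , refl)

          divergence : ∀ {s₁ s₂} (f : ℕ → State S₁) → f zero ≡ s₁ →
            (∀ k → Step S₁ (f k) τ (f (suc k))) → (∀ k → Rel (f k) s₂) →
            ∃[ s₂' ] ∃[ k ] (_↠⁺_ S₂ s₂ s₂' × Rel (f k) s₂')
          divergence f _ run related with related zero
          ... | c , start , _ = ⊥-elim (abs-no-τ c (subst (λ p → E₁ ⊢ p ⟶[ τ ] proj₁ (f 1)) start (run zero)))

      -- a concrete step is visible (matched by the abstract side) or inert
      -- (matched by standing still); concrete τ-runs are finite
      concrete-half : HalfDPBB S₂ S₁ (flip Rel)
      concrete-half = (λ {s₂} {s₁} {a} {s₂'} → transfer {s₂} {s₁} {a} {s₂'}) ,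
                      (λ {s₂} {s₁} → termination {s₂} {s₁}) ,
                      (λ {s₂} {s₁} → divergence {s₂} {s₁})
        where
          transfer : ∀ {s₂ s₁ a s₂'} → Rel s₁ s₂ → Step S₂ s₂ a s₂' →
            ∃[ s₁'' ] ∃[ s₁' ] (_↠_ S₁ s₁ s₁'' × StepOpt S₁ s₁'' a s₁' × Rel s₁'' s₂ × Rel s₁' s₂')
          transfer {_ , _} {p , ρ} (c , refl , refl) h with emb-steps h
          ... | inj₁ (c' , visible , refl) =
            (p , ρ) , (abs c' , step ρ (visible-abs visible)) , ↠-refl , inj₁ (visible-abs visible) ,
            (c , refl , refl) , (c' , refl , refl)
          ... | inj₂ (refl , inert c' refl same _) =
            (p , ρ) , (p , ρ) , ↠-refl , inj₂ (refl , refl) , (c , refl , refl) , (c' , sym same , refl)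

          termination : ∀ {s₂ s₁} → Rel s₁ s₂ → Final S₂ s₂ → ∃[ s₁' ] (_↠_ S₁ s₁ s₁' × Final S₁ s₁' × Rel s₁' s₂)
          termination {_ , _} {p , ρ} (c , refl , refl) final = (p , ρ) , ↠-refl , abs-final final , (c , refl , refl)

          divergence : ∀ {s₂ s₁} (f : ℕ → State S₂) → f zero ≡ s₂ →
            (∀ k → Step S₂ (f k) τ (f (suc k))) → (∀ k → Rel s₁ (f k)) →
            ∃[ s₁' ] ∃[ k ] (_↠⁺_ S₁ s₁ s₁' × Rel s₁' (f k))
          divergence f _ run related with related zero
          ... | c , _ , start = ⊥-elim (no-divergence c (<-wellFounded (μ c)) (proj₁ ∘ f) start run)

    bisimilar : ∀ c₀ → 𝒯 E₁ (abs c₀) ≈Δ 𝒯 E₂ (emb c₀)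
    bisimilar c₀ = Rel c₀ , (abstract-half c₀ , concrete-half c₀) , (c₀ , refl , refl)

snoc-map : ∀ {X Y : Set} (ws vs : List Y) (f : X → Y) (xs : List X) (x : X) →
  ws ++ vs ++ map f (xs ∷ʳ x) ≡ (ws ++ vs ++ map f xs) ∷ʳ f x
snoc-map ws vs f xs x = begin
  ws ++ vs ++ map f (xs ∷ʳ x)      ≡⟨ cong (λ t → ws ++ vs ++ t) (map-++ f xs [ x ]) ⟩
  ws ++ vs ++ (map f xs ∷ʳ f x)    ≡⟨ cong (ws ++_) (sym (++-assoc vs (map f xs) [ f x ])) ⟩
  ws ++ ((vs ++ map f xs) ∷ʳ f x)  ≡⟨ sym (++-assoc ws (vs ++ map f xs) [ f x ]) ⟩
  (ws ++ vs ++ map f xs) ∷ʳ f x    ∎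
  where open ≡-Reasoning

unsnoc-∷ʳ : ∀ {X : Set} (xs : List X) (x : X) → unsnoc (xs ∷ʳ x) ≡ just (xs , x)
unsnoc-∷ʳ [] x = refl
unsnoc-∷ʳ (y ∷ xs) x rewrite unsnoc-∷ʳ xs x = refl

-- twice the length: one unit for each of the two queue operations spent per symbol
weight : ∀ {X : Set} → List X → ℕ
weight [] = zero
weight (_ ∷ xs) = suc (suc (weight xs))

weight-∷ʳ : ∀ {X : Set} (xs : List X) (x : X) → weight (xs ∷ʳ x) ≡ suc (suc (weight xs))
weight-∷ʳ [] x = refl
weight-∷ʳ (_ ∷ xs) x = cong (suc ∘ suc) (weight-∷ʳ xs x)

-- Tape normal forms: the tape moves are insensitive to blanks at the ends,
-- so they commute with the normalisation performed by tape.

module TapeNormalForm {n : ℕ} where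

  stripL-idem : (xs : List (DB n)) → stripL (stripL xs) ≡ stripL xs
  stripL-idem [] = refl
  stripL-idem (□ ∷ xs) = stripL-idem xs
  stripL-idem (dat x ∷ xs) = refl

  stripL-++ : (xs ys : List (DB n)) → stripL (xs ++ ys) ≡ stripL (stripL xs ++ ys)
  stripL-++ [] ys = refl
  stripL-++ (□ ∷ xs) ys = stripL-++ xs ys
  stripL-++ (dat x ∷ xs) ys = refl

  stripL-∷ʳ : (xs : List (DB n)) (e : DB n) →
    (stripL xs ≡ [] × e ≡ □ × stripL (xs ∷ʳ e) ≡ []) ⊎ stripL (xs ∷ʳ e) ≡ stripL xs ∷ʳ e
  stripL-∷ʳ [] □ = inj₁ (refl , refl , refl)
  stripL-∷ʳ [] (dat x) = inj₂ refl
  stripL-∷ʳ (□ ∷ xs) e = stripL-∷ʳ xs e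
  stripL-∷ʳ (dat x ∷ xs) e = inj₂ refl

  stripR-idem : (xs : List (DB n)) → stripR (stripR xs) ≡ stripR xs
  stripR-idem xs rewrite reverse-involutive (stripL (reverse xs)) | stripL-idem (reverse xs) = refl

  stripR-∷ : (ys : List (DB n)) (e : DB n) →
    (stripR ys ≡ [] × e ≡ □ × stripR (e ∷ ys) ≡ []) ⊎ stripR (e ∷ ys) ≡ e ∷ stripR ys
  stripR-∷ ys e rewrite unfold-reverse e ys with stripL-∷ʳ (reverse ys) e
  ... | inj₁ (blank , e-blank , blank') rewrite blank | blank' = inj₁ (refl , e-blank , refl)
  ... | inj₂ eq rewrite eq | reverse-++ (stripL (reverse ys)) [ e ] = inj₂ refl

  stripR-∷-stripR : (ys : List (DB n)) (d : DB n) → stripR (d ∷ stripR ys) ≡ stripR (d ∷ ys)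
  stripR-∷-stripR ys d rewrite unfold-reverse d (stripR ys) | unfold-reverse d ys
    | reverse-involutive (stripL (reverse ys)) | sym (stripL-++ (reverse ys) [ d ]) = refl

  tape-idem : (δl : List (DB n)) (d : DB n) (δr : List (DB n)) → tape (stripL δl) d (stripR δr) ≡ tape δl d δr
  tape-idem δl d δr rewrite stripL-idem δl | stripR-idem δr = refl

  moveL-∷ʳ : (l : List (DB n)) (e d : DB n) (δr : List (DB n)) → moveL (l ∷ʳ e , d , δr) ≡ tape l e (d ∷ δr)
  moveL-∷ʳ l e d δr rewrite unsnoc-∷ʳ l e = refl

  moveL-norm : (δl : List (DB n)) (d : DB n) (δr : List (DB n)) → moveL (tape δl d δr) ≡ moveL (δl , d , δr)
  moveL-norm δl d δr with initLast δl
  ... | [] = cong (λ t → [] , □ , t) (stripR-∷-stripR δr d)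
  ... | l ∷ʳ′ e with stripL-∷ʳ l e
  ...   | inj₁ (blank , refl , blank') rewrite blank' | unsnoc-∷ʳ l □ | blank =
    cong (λ t → [] , □ , t) (stripR-∷-stripR δr d)
  ...   | inj₂ eq rewrite eq | unsnoc-∷ʳ (stripL l) e | unsnoc-∷ʳ l e | stripL-idem l =
    cong (λ t → stripL l , e , t) (stripR-∷-stripR δr d)

  moveR-norm : (δl : List (DB n)) (d : DB n) (δr : List (DB n)) → moveR (tape δl d δr) ≡ moveR (δl , d , δr)
  moveR-norm δl d [] = cong (λ t → t , □ , []) (sym (stripL-++ δl [ d ]))
  moveR-norm δl d (e ∷ δr) with stripR-∷ δr e
  ... | inj₁ (blank , refl , blank') rewrite blank' | blank = cong (λ t → t , □ , []) (sym (stripL-++ δl [ d ]))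
  ... | inj₂ eq rewrite eq | stripR-idem δr = cong (λ t → t , e , stripR δr) (sym (stripL-++ δl [ d ]))

open TapeNormalForm

-- A symbol carried by the controller while it rotates the queue for a right
-- move: a datum or the separator ⊥ (never $).
data Carry (n : ℕ) : Set where
  cd : DB n → Carry n
  c⊥ : Carry n

module Machine {A : Set} {n : ℕ} where

  Name : Set
  Name = CName n ⊎ List (Sym n)

  P : Set
  P = Proc A n Name

  T : Spec A n (TapeName n)
  T = E-T∞

  E : Spec A n Name
  E = E-TQ

  IO : List Chan
  IO = i ∷ o ∷ []

  sys : P → List (Sym n) → P
  sys p σ = ⟦ p ∥ var (inj₂ σ) ⟧ IO

  C : CName n → P
  C X = var (inj₁ X)

  ‼-injective : ∀ {c c' : Chan} {v v' : Val n} → _≡_ {A = Act A n} (c ‼ v) (c' ‼ v') → v ≡ v'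
  ‼-injective refl = refl

  ⁇-injective : ∀ {c c' : Chan} {v v' : Val n} → _≡_ {A = Act A n} (c ⁇ v) (c' ⁇ v') → v ≡ v'
  ⁇-injective refl = refl

  symVal-injective : ∀ {y z : Sym n} → symVal y ≡ symVal z → y ≡ z
  symVal-injective {sd _} {sd _} refl = refl
  symVal-injective {s⊥} {s⊥} refl = refl
  symVal-injective {s$} {s$} refl = refl

  Qbody : List (Sym n) → P
  Qbody σ = rename inj₂ (E-Q∞ σ)

  queue-input : ∀ σ y → E ⊢ var (inj₂ σ) ⟶[ i ⁇ symVal y ] var (inj₂ (y ∷ σ))
  queue-input σ y = rec (body σ (initLast σ))
    where
      body : ∀ σ → InitLast σ → E ⊢ Qbody σ ⟶[ i ⁇ symVal y ] var (inj₂ (y ∷ σ))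
      body .[] [] = sumˡ (rename-sumP-in inj₂ (allSym n) _ (∈-allSym y) pre)
      body .(σ' ∷ʳ x) (σ' ∷ʳ′ x) rewrite unsnoc-∷ʳ σ' x =
        sumʳ (sumˡ (rename-sumP-in inj₂ (allSym n) _ (∈-allSym y) pre))

  queue-output : ∀ σ x → E ⊢ var (inj₂ (σ ∷ʳ x)) ⟶[ o ‼ symVal x ] var (inj₂ σ)
  queue-output σ x = rec body
    where
      body : E ⊢ Qbody (σ ∷ʳ x) ⟶[ o ‼ symVal x ] var (inj₂ σ)
      body rewrite unsnoc-∷ʳ σ x = sumˡ pre

  queue-final : ∀ σ → E ⊢ var (inj₂ σ) ↓
  queue-final σ = rec body
    where
      body : E ⊢ Qbody σ ↓
      body with unsnoc σ
      ... | nothing = sumʳ one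
      ... | just _ = sumʳ (sumʳ one)

  queue-steps : ∀ σ {a q} → E ⊢ var (inj₂ σ) ⟶[ a ] q →
    (∃[ y ] (a ≡ i ⁇ symVal y × q ≡ var (inj₂ (y ∷ σ)))) ⊎
    (∃[ σ' ] ∃[ x ] (σ ≡ σ' ∷ʳ x × a ≡ o ‼ symVal x × q ≡ var (inj₂ σ')))
  queue-steps σ (rec h) = body σ (initLast σ) h
    where
      body : ∀ σ → InitLast σ → ∀ {a q} → E ⊢ Qbody σ ⟶[ a ] q →
        (∃[ y ] (a ≡ i ⁇ symVal y × q ≡ var (inj₂ (y ∷ σ)))) ⊎
        (∃[ σ' ] ∃[ x ] (σ ≡ σ' ∷ʳ x × a ≡ o ‼ symVal x × q ≡ var (inj₂ σ')))
      body .[] [] (sumˡ h) with rename-sumP-inv inj₂ (allSym n) _ h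
      ... | y , _ , pre = inj₁ (y , refl , refl)
      body .(σ' ∷ʳ x) (σ' ∷ʳ′ x) h rewrite unsnoc-∷ʳ σ' x with h
      ... | sumˡ pre = inj₂ (σ' , x , refl , refl , refl)
      ... | sumʳ (sumˡ h') with rename-sumP-inv inj₂ (allSym n) _ h'
      ...   | y , _ , pre = inj₁ (y , refl , refl)

  sys-steps : ∀ {p σ a q} → E ⊢ sys p σ ⟶[ a ] q →
    (∃[ p' ] (E ⊢ p ⟶[ a ] p' × ¬ InI IO a × q ≡ sys p' σ)) ⊎
    (∃[ y ] ∃[ p' ] (a ≡ τ × E ⊢ p ⟶[ i ‼ symVal y ] p' × q ≡ sys p' (y ∷ σ))) ⊎
    (∃[ σ' ] ∃[ x ] ∃[ p' ] (a ≡ τ × σ ≡ σ' ∷ʳ x × E ⊢ p ⟶[ o ⁇ symVal x ] p' × q ≡ sys p' σ'))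
  sys-steps (parˡ h outside) = inj₁ (_ , h , outside , refl)
  sys-steps {σ = σ} (parʳ h outside) with queue-steps σ h
  ... | inj₁ (_ , refl , _) = ⊥-elim (outside (i , here refl , _ , inj₁ refl))
  ... | inj₂ (_ , _ , _ , refl , _) = ⊥-elim (outside (o , there (here refl) , _ , inj₂ refl))
  sys-steps {σ = σ} (comm₁ _ hp hq) with queue-steps σ hq
  ... | inj₂ (σ' , x , split , refl , refl) = inj₂ (inj₂ (σ' , x , _ , refl , split , hp , refl))
  sys-steps {σ = σ} (comm₂ _ hp hq) with queue-steps σ hq
  ... | inj₁ (y , refl , refl) = inj₂ (inj₁ (y , _ , refl , hp , refl))

  Writer : P → Sym n → P → Set
  Writer p z p' = E ⊢ p ⟶[ i ‼ symVal z ] p' × (∀ {a q} → E ⊢ p ⟶[ a ] q → a ≡ i ‼ symVal z × q ≡ p')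

  Reader : P → (Sym n → P) → Set
  Reader p next = ∀ {a q} → E ⊢ p ⟶[ a ] q → ∃[ x ] (a ≡ o ⁇ symVal x × q ≡ next x)

  reader-deterministic : ∀ {p next x q} → Reader p next → E ⊢ p ⟶[ o ⁇ symVal x ] q → q ≡ next x
  reader-deterministic reads h with reads h
  ... | _ , same , refl with symVal-injective (⁇-injective same)
  ...   | refl = refl

  writer-steps : ∀ {p z p' σ a q} → Writer p z p' → E ⊢ sys p σ ⟶[ a ] q → a ≡ τ × q ≡ sys p' (z ∷ σ)
  writer-steps (_ , only) h with sys-steps h
  ... | inj₁ (_ , hp , outside , _) with only hp
  ...   | refl , _ = ⊥-elim (outside (i , here refl , _ , inj₂ refl))
  writer-steps (_ , only) h | inj₂ (inj₁ (_ , _ , refl , hp , refl)) with only hp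
  ...   | same , refl with symVal-injective (‼-injective same)
  ...     | refl = refl , refl
  writer-steps (_ , only) h | inj₂ (inj₂ (_ , _ , _ , refl , _ , hp , _)) with only hp
  ...   | () , _

  reader-steps : ∀ {p next p' σ x a q} → Reader p next → E ⊢ p ⟶[ o ⁇ symVal x ] p' →
    E ⊢ sys p (σ ∷ʳ x) ⟶[ a ] q → a ≡ τ × q ≡ sys p' σ
  reader-steps reads _ h with sys-steps h
  ... | inj₁ (_ , hp , outside , _) with reads hp
  ...   | _ , refl , _ = ⊥-elim (outside (o , there (here refl) , _ , inj₁ refl))
  reader-steps reads _ h | inj₂ (inj₁ (_ , _ , _ , hp , _)) with reads hp
  ...   | _ , () , _
  reader-steps {σ = σ} reads receive h | inj₂ (inj₂ (σ' , _ , _ , refl , split , hp , refl))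
    with ∷ʳ-injective σ σ' split
  ...   | refl , refl = refl , cong (λ p → sys p σ) (trans (reader-deterministic reads hp)
                                                          (sym (reader-deterministic reads receive)))

  idle-steps : ∀ {d a p'} → E ⊢ C (H d) ⟶[ a ] p' →
    (a ≡ r ‼ vd d × p' ≡ C (H d)) ⊎ (∃[ e ] (a ≡ w ⁇ vd e × p' ≡ C (H e))) ⊎
    (a ≡ m ⁇ vL × p' ≡ C (HL d)) ⊎ (a ≡ m ⁇ vR × p' ≡ C (HR d))
  idle-steps (rec (sumˡ pre)) = inj₁ (refl , refl)
  idle-steps (rec (sumʳ (sumˡ h))) with rename-sumP-inv inj₁ (allDB n) _ h
  ... | e , _ , pre = inj₂ (inj₁ (e , refl , refl))
  idle-steps (rec (sumʳ (sumʳ (sumˡ pre)))) = inj₂ (inj₂ (inj₁ (refl , refl)))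
  idle-steps (rec (sumʳ (sumʳ (sumʳ (sumˡ pre))))) = inj₂ (inj₂ (inj₂ (refl , refl)))

  idle-final : ∀ {d} → E ⊢ C (H d) ↓
  idle-final = rec (sumʳ (sumʳ (sumʳ (sumʳ one))))

  -- H^L_d after sending d: waits for the last symbol of the left part (or ⊥)
  left-read : P
  left-read = rename inj₁ (sumP (allDB n) (λ e → (o ⁇ vd e) ∙ var (H e))
                           ⊕ (o ⁇ v⊥) ∙ (i ‼ v$) ∙ (i ‼ v⊥) ∙ var Back)

  -- H^R_d after sending $ and d: waits for the first symbol to carry
  right-read : P
  right-read = rename inj₁ (sumP (allDB n) (λ e → (o ⁇ vd e) ∙ var (Fwd e)) ⊕ (o ⁇ v⊥) ∙ var Fwd⊥)

  cs : Carry n → Sym n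
  cs (cd d) = sd d
  cs c⊥ = s⊥

  fname : Carry n → CName n
  fname (cd d) = Fwd d
  fname c⊥ = Fwd⊥

  fwd-end : Carry n → P
  fwd-end (cd d) = C (H d)
  fwd-end c⊥ = (i ‼ v⊥) ∙ C (H □)

  prefix-writes : ∀ z {p} → Writer ((i ‼ symVal z) ∙ p) z p
  prefix-writes _ = pre , λ { pre → refl , refl }

  left-writes : ∀ {d} → Writer (C (HL d)) (sd d) left-read
  left-writes = rec pre , λ { (rec pre) → refl , refl }

  right-writes : ∀ {d} → Writer (C (HR d)) s$ ((i ‼ vd d) ∙ right-read)
  right-writes = rec pre , λ { (rec pre) → refl , refl }

  -- the successors of the reading states (𝟘 for symbols they do not accept)
  after-left : Sym n → P
  after-left (sd e) = C (H e)
  after-left s⊥ = (i ‼ v$) ∙ (i ‼ v⊥) ∙ C Back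
  after-left s$ = 𝟘

  after-back : Sym n → P
  after-back (sd e) = (i ‼ vd e) ∙ C Back
  after-back s⊥ = 𝟘
  after-back s$ = C (H □)

  after-right : Sym n → P
  after-right (sd e) = C (Fwd e)
  after-right s⊥ = C Fwd⊥
  after-right s$ = 𝟘

  after-fwd : Carry n → Sym n → P
  after-fwd c (sd e) = (i ‼ symVal (cs c)) ∙ C (Fwd e)
  after-fwd (cd d) s⊥ = (i ‼ vd d) ∙ C Fwd⊥
  after-fwd c⊥ s⊥ = 𝟘
  after-fwd c s$ = fwd-end c

  left-reads : Reader left-read after-left
  left-reads (sumˡ h) with rename-sumP-inv inj₁ (allDB n) _ h
  ... | e , _ , pre = sd e , refl , refl
  left-reads (sumʳ pre) = s⊥ , refl , refl

  back-reads : Reader (C Back) after-back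
  back-reads (rec (sumˡ h)) with rename-sumP-inv inj₁ (allDB n) _ h
  ... | e , _ , pre = sd e , refl , refl
  back-reads (rec (sumʳ pre)) = s$ , refl , refl

  right-reads : Reader right-read after-right
  right-reads (sumˡ h) with rename-sumP-inv inj₁ (allDB n) _ h
  ... | e , _ , pre = sd e , refl , refl
  right-reads (sumʳ pre) = s⊥ , refl , refl

  fwd-reads : ∀ c → Reader (C (fname c)) (after-fwd c)
  fwd-reads (cd d) (rec (sumˡ h)) with rename-sumP-inv inj₁ (allDB n) _ h
  ... | e , _ , pre = sd e , refl , refl
  fwd-reads (cd d) (rec (sumʳ (sumˡ pre))) = s⊥ , refl , refl
  fwd-reads (cd d) (rec (sumʳ (sumʳ pre))) = s$ , refl , refl
  fwd-reads c⊥ (rec (sumˡ h)) with rename-sumP-inv inj₁ (allDB n) _ h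
  ... | e , _ , pre = sd e , refl , refl
  fwd-reads c⊥ (rec (sumʳ pre)) = s$ , refl , refl

  left-receives : ∀ e → E ⊢ left-read ⟶[ o ⁇ vd e ] C (H e)
  left-receives e = sumˡ (rename-sumP-in inj₁ (allDB n) _ (∈-allDB e) pre)

  back-receives : ∀ e → E ⊢ C Back ⟶[ o ⁇ vd e ] ((i ‼ vd e) ∙ C Back)
  back-receives e = rec (sumˡ (rename-sumP-in inj₁ (allDB n) _ (∈-allDB e) pre))

  right-receives : ∀ e → E ⊢ right-read ⟶[ o ⁇ vd e ] C (Fwd e)
  right-receives e = sumˡ (rename-sumP-in inj₁ (allDB n) _ (∈-allDB e) pre)

  -- Fwd carrying c receives y and sends c on; only the separator cannot follow itself
  fwd-receives : ∀ c y → (c ≡ c⊥ → y ≡ c⊥ → ⊥) →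
    E ⊢ C (fname c) ⟶[ o ⁇ symVal (cs y) ] ((i ‼ symVal (cs c)) ∙ C (fname y))
  fwd-receives (cd d) (cd e) _ = rec (sumˡ (rename-sumP-in inj₁ (allDB n) _ (∈-allDB e) pre))
  fwd-receives (cd d) c⊥ _ = rec (sumʳ (sumˡ pre))
  fwd-receives c⊥ (cd e) _ = rec (sumˡ (rename-sumP-in inj₁ (allDB n) _ (∈-allDB e) pre))
  fwd-receives c⊥ c⊥ apart = ⊥-elim (apart refl refl)

  fwd-receives-$ : ∀ c → E ⊢ C (fname c) ⟶[ o ⁇ v$ ] fwd-end c
  fwd-receives-$ (cd d) = rec (sumʳ (sumʳ pre))
  fwd-receives-$ c⊥ = rec (sumʳ pre)

  -- The queue always holds the tape read from
  -- δR towards δL, with ⊥ between them: idle is [H_d ∥ Q_{δR⊥δL}].  A left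
  -- move sends d and reads the last symbol e of δL (becoming H_e); if δL is
  -- empty it reads ⊥ instead and rotates the whole queue once, marked by $,
  -- through Back.  A right move marks the queue with $ d and rotates it
  -- through Fwd, shifting every symbol by one position; the carried symbol
  -- at $ is the new head.

  carries : List (DB n) → List (DB n) → List (Carry n)
  carries δL δR = map cd δR ++ c⊥ ∷ map cd δL

  data Cfg : Set where
    idle : (δL : List (DB n)) (d : DB n) (δR : List (DB n)) → Cfg
    left₁ left₂ : (δL : List (DB n)) (d : DB n) (δR : List (DB n)) → Cfg
    left-end₁ left-end₂ : (d : DB n) (δR : List (DB n)) → Cfg
    -- Back with α still to be rotated and β already rotated
    back : (α β : List (DB n)) → Cfg
    back-emit : (α : List (DB n)) (e : DB n) (β : List (DB n)) → Cfg
    right₁ right₂ right₃ : (δL : List (DB n)) (d : DB n) (δR : List (DB n)) → Cfg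
    -- Fwd carrying c, with U still in the queue and Z already shifted
    forward : (δL : List (DB n)) (d : DB n) (δR : List (DB n)) (c : Carry n) (U Z : List (Carry n)) →
              carries δL δR ≡ U ++ c ∷ Z → Cfg
    forward-emit : (δL : List (DB n)) (d : DB n) (δR : List (DB n)) (c y : Carry n) (U Z : List (Carry n)) →
                   carries δL δR ≡ U ++ y ∷ c ∷ Z → Cfg
    -- Fwd_⊥ after $ when δR was empty: sending the final ⊥
    forward-end : (δL : List (DB n)) (d : DB n) → Cfg

  embed : Cfg → P
  embed (idle δL d δR) = sys (C (H d)) (qword δL δR)
  embed (left₁ δL d δR) = sys (C (HL d)) (qword δL δR)
  embed (left₂ δL d δR) = sys left-read (sd d ∷ qword δL δR)
  embed (left-end₁ d δR) = sys ((i ‼ v$) ∙ (i ‼ v⊥) ∙ C Back) (sd d ∷ map sd δR)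
  embed (left-end₂ d δR) = sys ((i ‼ v⊥) ∙ C Back) (s$ ∷ sd d ∷ map sd δR)
  embed (back α β) = sys (C Back) (map sd β ++ s⊥ ∷ s$ ∷ map sd α)
  embed (back-emit α e β) = sys ((i ‼ vd e) ∙ C Back) (map sd β ++ s⊥ ∷ s$ ∷ map sd α)
  embed (right₁ δL d δR) = sys (C (HR d)) (qword δL δR)
  embed (right₂ δL d δR) = sys ((i ‼ vd d) ∙ right-read) (s$ ∷ qword δL δR)
  embed (right₃ δL d δR) = sys right-read (sd d ∷ s$ ∷ qword δL δR)
  embed (forward _ d _ c U Z _) = sys (C (fname c)) (map cs Z ++ sd d ∷ s$ ∷ map cs U)
  embed (forward-emit _ d _ c y U Z _) =
    sys ((i ‼ symVal (cs c)) ∙ C (fname y)) (map cs Z ++ sd d ∷ s$ ∷ map cs U)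
  embed (forward-end δL d) = sys ((i ‼ v⊥) ∙ C (H □)) (map sd δL ++ sd d ∷ [])

  -- the tape a configuration represents: after a move, the moved tape
  tapeOf : Cfg → TapeName n
  tapeOf (idle δL d δR) = tape δL d δR
  tapeOf (left₁ δL d δR) = moveL (tape δL d δR)
  tapeOf (left₂ δL d δR) = moveL (tape δL d δR)
  tapeOf (left-end₁ d δR) = tape [] □ (d ∷ δR)
  tapeOf (left-end₂ d δR) = tape [] □ (d ∷ δR)
  tapeOf (back α β) = tape [] □ (α ++ β)
  tapeOf (back-emit α e β) = tape [] □ (α ++ e ∷ β)
  tapeOf (right₁ δL d δR) = moveR (tape δL d δR)
  tapeOf (right₂ δL d δR) = moveR (tape δL d δR)
  tapeOf (right₃ δL d δR) = moveR (tape δL d δR)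
  tapeOf (forward δL d δR _ _ _ _) = moveR (tape δL d δR)
  tapeOf (forward-emit δL d δR _ _ _ _ _) = moveR (tape δL d δR)
  tapeOf (forward-end δL d) = moveR (tape δL d [])

  -- an upper bound on the number of internal steps left until idle
  μ : Cfg → ℕ
  μ (idle _ _ _) = 0
  μ (left₁ _ _ δR) = 7 + weight δR
  μ (left₂ _ _ δR) = 6 + weight δR
  μ (left-end₁ _ δR) = 5 + weight δR
  μ (left-end₂ _ δR) = 4 + weight δR
  μ (back α _) = 1 + weight α
  μ (back-emit α _ _) = 2 + weight α
  μ (right₁ δL _ δR) = 3 + weight (carries δL δR)
  μ (right₂ δL _ δR) = 2 + weight (carries δL δR)
  μ (right₃ δL _ δR) = 1 + weight (carries δL δR)
  μ (forward _ _ _ _ U _ _) = 2 + weight U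
  μ (forward-emit _ _ _ _ _ U _ _) = 3 + weight U
  μ (forward-end _ _) = 1

  data IsIdle : Cfg → Set where
    is-idle : ∀ δL d δR → IsIdle (idle δL d δR)

  data Visible : Cfg → Act A n → Cfg → Set where
    read  : ∀ δL d δR → Visible (idle δL d δR) (r ‼ vd d) (idle δL d δR)
    write : ∀ δL d δR e → Visible (idle δL d δR) (w ⁇ vd e) (idle δL e δR)
    left  : ∀ δL d δR → Visible (idle δL d δR) (m ⁇ vL) (left₁ δL d δR)
    right : ∀ δL d δR → Visible (idle δL d δR) (m ⁇ vR) (right₁ δL d δR)

  open Abstraction {A} T E (var ∘ tapeOf) embed μ IsIdle Visible public

  unsynchronised : ∀ {c v} {a : Act A n} → c ≢ i → c ≢ o → (a ≡ c ⁇ v ⊎ a ≡ c ‼ v) → ¬ InI IO a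
  unsynchronised c≢i c≢o (inj₁ refl) (_ , here refl , _ , inj₁ refl) = c≢i refl
  unsynchronised c≢i c≢o (inj₁ refl) (_ , there (here refl) , _ , inj₁ refl) = c≢o refl
  unsynchronised c≢i c≢o (inj₂ refl) (_ , here refl , _ , inj₂ refl) = c≢i refl
  unsynchronised c≢i c≢o (inj₂ refl) (_ , there (here refl) , _ , inj₂ refl) = c≢o refl

  visible-tape : ∀ {c a c'} → Visible c a c' → T ⊢ var (tapeOf c) ⟶[ a ] var (tapeOf c')
  visible-tape (read δL d δR) =
    subst (λ t → T ⊢ var (tape δL d δR) ⟶[ r ‼ vd d ] var t) (tape-idem δL d δR) (rec (sumˡ pre))
  visible-tape (write δL d δR e) =
    subst (λ t → T ⊢ var (tape δL d δR) ⟶[ w ⁇ vd e ] var t) (tape-idem δL e δR)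
      (rec (sumʳ (sumˡ (sumP-in (allDB n) _ (∈-allDB e) pre))))
  visible-tape (left δL d δR) = rec (sumʳ (sumʳ (sumˡ pre)))
  visible-tape (right δL d δR) = rec (sumʳ (sumʳ (sumʳ (sumˡ pre))))

  visible-system : ∀ {c a c'} → Visible c a c' → E ⊢ embed c ⟶[ a ] embed c'
  visible-system (read _ _ _) = parˡ (rec (sumˡ pre)) (unsynchronised (λ ()) (λ ()) (inj₂ refl))
  visible-system (write _ _ _ e) =
    parˡ (rec (sumʳ (sumˡ (rename-sumP-in inj₁ (allDB n) _ (∈-allDB e) pre)))) (unsynchronised (λ ()) (λ ()) (inj₁ refl))
  visible-system (left _ _ _) = parˡ (rec (sumʳ (sumʳ (sumˡ pre)))) (unsynchronised (λ ()) (λ ()) (inj₁ refl))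
  visible-system (right _ _ _) = parˡ (rec (sumʳ (sumʳ (sumʳ (sumˡ pre))))) (unsynchronised (λ ()) (λ ()) (inj₁ refl))

  tape-steps : ∀ {δL d δR a q} → T ⊢ var (tape δL d δR) ⟶[ a ] q →
    ∃[ c' ] (Visible (idle δL d δR) a c' × q ≡ var (tapeOf c'))
  tape-steps {δL} {d} {δR} (rec (sumˡ pre)) = _ , read δL d δR , cong var (tape-idem δL d δR)
  tape-steps {δL} {d} {δR} (rec (sumʳ (sumˡ h))) with sumP-inv (allDB n) _ h
  ... | e , _ , pre = _ , write δL d δR e , cong var (tape-idem δL e δR)
  tape-steps {δL} {d} {δR} (rec (sumʳ (sumʳ (sumˡ pre)))) = _ , left δL d δR , refl
  tape-steps {δL} {d} {δR} (rec (sumʳ (sumʳ (sumʳ (sumˡ pre))))) = _ , right δL d δR , refl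

  tape-final : ∀ t → T ⊢ var t ↓
  tape-final t = rec (sumʳ (sumʳ (sumʳ (sumʳ one))))

  idle-visible : ∀ {δL d δR a q} → E ⊢ embed (idle δL d δR) ⟶[ a ] q →
    ∃[ c' ] (Visible (idle δL d δR) a c' × q ≡ embed c')
  idle-visible {δL} {d} {δR} h with sys-steps h
  ... | inj₁ (_ , hp , _ , refl) with idle-steps hp
  ...   | inj₁ (refl , refl) = _ , read δL d δR , refl
  ...   | inj₂ (inj₁ (e , refl , refl)) = _ , write δL d δR e , refl
  ...   | inj₂ (inj₂ (inj₁ (refl , refl))) = _ , left δL d δR , refl
  ...   | inj₂ (inj₂ (inj₂ (refl , refl))) = _ , right δL d δR , refl
  idle-visible h | inj₂ (inj₁ (_ , _ , refl , hp , _)) with idle-steps hp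
  ... | inj₁ (() , _)
  ... | inj₂ (inj₁ (_ , () , _))
  ... | inj₂ (inj₂ (inj₁ (() , _)))
  ... | inj₂ (inj₂ (inj₂ (() , _)))
  idle-visible h | inj₂ (inj₂ (_ , _ , _ , refl , _ , hp , _)) with idle-steps hp
  ... | inj₁ (() , _)
  ... | inj₂ (inj₁ (_ , () , _))
  ... | inj₂ (inj₂ (inj₁ (() , _)))
  ... | inj₂ (inj₂ (inj₂ (() , _)))

  qword-∷ʳ : ∀ (l : List (DB n)) e δR → qword (l ∷ʳ e) δR ≡ qword l δR ∷ʳ sd e
  qword-∷ʳ l e δR = snoc-map (map sd δR) [ s⊥ ] sd l e

  carries-∷ʳ : ∀ (l : List (DB n)) e δR → carries (l ∷ʳ e) δR ≡ carries l δR ∷ʳ cd e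
  carries-∷ʳ l e δR = snoc-map (map cd δR) [ c⊥ ] cd l e

  cs-carries : ∀ δL δR → map cs (carries δL δR) ≡ qword δL δR
  cs-carries δL δR = begin
    map cs (map cd δR ++ c⊥ ∷ map cd δL)          ≡⟨ map-++ cs (map cd δR) (c⊥ ∷ map cd δL) ⟩
    map cs (map cd δR) ++ s⊥ ∷ map cs (map cd δL) ≡⟨ cong (λ t → t ++ s⊥ ∷ map cs (map cd δL)) (sym (map-∘ {g = cs} {f = cd} δR)) ⟩
    map sd δR ++ s⊥ ∷ map cs (map cd δL)          ≡⟨ cong (λ t → map sd δR ++ s⊥ ∷ t) (sym (map-∘ {g = cs} {f = cd} δL)) ⟩
    qword δL δR                                   ∎
    where open ≡-Reasoning

  -- carries δL δR contains a single separator, so two separators are never adjacent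
  single-separator : ∀ δL δR U Z → carries δL δR ≢ U ++ c⊥ ∷ c⊥ ∷ Z
  single-separator δL δR U Z = separated δR U
    where
      no-separator : ∀ (xs : List (DB n)) V W → map cd xs ≢ V ++ c⊥ ∷ W
      no-separator (_ ∷ _) [] W ()
      no-separator (_ ∷ xs) (_ ∷ V) W eq = no-separator xs V W (proj₂ (∷-injective eq))

      separated : ∀ δR U → carries δL δR ≢ U ++ c⊥ ∷ c⊥ ∷ Z
      separated [] [] eq = no-separator δL [] Z (proj₂ (∷-injective eq))
      separated [] (_ ∷ U) eq = no-separator δL U (c⊥ ∷ Z) (proj₂ (∷-injective eq))
      separated (_ ∷ δR) (_ ∷ U) eq = separated δR U (proj₂ (∷-injective eq))

  inert-to : ∀ {c q} c' → q ≡ embed c' → tapeOf c' ≡ tapeOf c → μ c' < μ c → Inert c q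
  inert-to c' reached same lt = inert c' reached (cong var same) lt

  data Phase (c : Cfg) : Set where
    writing : ∀ {p z p' σ} → embed c ≡ sys p σ → Writer p z p' → Inert c (sys p' (z ∷ σ)) → Phase c
    reading : ∀ {p next p'} σ x → embed c ≡ sys p (σ ∷ʳ x) → Reader p next →
              E ⊢ p ⟶[ o ⁇ symVal x ] p' → Inert c (sys p' σ) → Phase c

  phase-steps : ∀ {c a q} → Phase c → E ⊢ embed c ⟶[ a ] q → a ≡ τ × Inert c q
  phase-steps (writing eq writes next) h with writer-steps writes (subst (λ s → E ⊢ s ⟶[ _ ] _) eq h)
  ... | refl , refl = refl , next
  phase-steps (reading _ _ eq reads receive next) h
    with reader-steps reads receive (subst (λ s → E ⊢ s ⟶[ _ ] _) eq h)
  ... | refl , refl = refl , next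

  phase-progress : ∀ {c} → Phase c → ∃[ q ] (E ⊢ embed c ⟶[ τ ] q × Inert c q)
  phase-progress (writing eq (send , _) next) =
    _ , subst (λ s → E ⊢ s ⟶[ τ ] _) (sym eq) (comm₂ (here refl) send (queue-input _ _)) , next
  phase-progress (reading σ x eq _ receive next) =
    _ , subst (λ s → E ⊢ s ⟶[ τ ] _) (sym eq) (comm₁ (there (here refl)) receive (queue-output σ x)) , next

  left-phase : ∀ δL d δR → Phase (left₂ δL d δR)
  left-phase δL d δR with initLast δL
  ... | [] = reading (sd d ∷ map sd δR) s⊥ refl left-reads (sumʳ pre)
               (inert-to (left-end₁ d δR) refl (sym (moveL-norm [] d δR)) ≤-refl)
  ... | l ∷ʳ′ e = reading (sd d ∷ qword l δR) (sd e) (cong (λ t → sys left-read (sd d ∷ t)) (qword-∷ʳ l e δR))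
               left-reads (left-receives e)
               (inert-to (idle l e (d ∷ δR)) refl (trans (sym (moveL-∷ʳ l e d δR)) (sym (moveL-norm (l ∷ʳ e) d δR))) z<s)

  back-phase : ∀ α β → Phase (back α β)
  back-phase α β with initLast α
  ... | [] = reading (map sd β ++ [ s⊥ ]) s$ (cong (sys (C Back)) (sym (++-assoc (map sd β) [ s⊥ ] [ s$ ])))
               back-reads (rec (sumʳ pre)) (inert-to (idle [] □ β) refl refl z<s)
  ... | α' ∷ʳ′ e = reading (map sd β ++ s⊥ ∷ s$ ∷ map sd α') (sd e)
               (cong (sys (C Back)) (snoc-map (map sd β) (s⊥ ∷ s$ ∷ []) sd α' e)) back-reads (back-receives e)
               (inert-to (back-emit α' e β) refl (cong (tape [] □) (sym (∷ʳ-++ α' e β)))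
                 (≤-reflexive (cong suc (sym (weight-∷ʳ α' e)))))

  right-phase : ∀ δL d δR → Phase (right₃ δL d δR)
  right-phase δL d δR with initLast δL
  ... | [] = reading (sd d ∷ s$ ∷ map sd δR) s⊥ refl right-reads (sumʳ pre)
               (inert-to (forward [] d δR c⊥ (map cd δR) [] refl)
                 (cong (λ t → sys (C Fwd⊥) (sd d ∷ s$ ∷ t)) (map-∘ {g = cs} {f = cd} δR)) refl
                 (≤-reflexive (cong suc (sym (weight-∷ʳ (map cd δR) c⊥)))))
  ... | l ∷ʳ′ e = reading (sd d ∷ s$ ∷ qword l δR) (sd e)
               (cong (λ t → sys right-read (sd d ∷ s$ ∷ t)) (qword-∷ʳ l e δR)) right-reads (right-receives e)
               (inert-to (forward (l ∷ʳ e) d δR (cd e) (carries l δR) [] (carries-∷ʳ l e δR))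
                 (cong (λ t → sys (C (Fwd e)) (sd d ∷ s$ ∷ t)) (sym (cs-carries l δR))) refl
                 (≤-reflexive (cong suc (sym (trans (cong weight (carries-∷ʳ l e δR)) (weight-∷ʳ (carries l δR) (cd e)))))))

  -- Fwd reads the next symbol and re-sends the carried one; at $ the carried
  -- symbol becomes the head of the moved tape
  forward-phase : ∀ δL d δR c U Z (eq : carries δL δR ≡ U ++ c ∷ Z) → Phase (forward δL d δR c U Z eq)
  forward-phase δL d δR c U Z eq with initLast U
  forward-phase δL d (e ∷ δR) (cd .e) .[] .(carries δL δR) refl | [] =
    reading (map cs (carries δL δR) ++ [ sd d ]) s$
      (cong (sys (C (Fwd e))) (sym (++-assoc (map cs (carries δL δR)) [ sd d ] [ s$ ])))
      (fwd-reads (cd e)) (fwd-receives-$ (cd e))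
      (inert-to (idle (δL ∷ʳ d) e δR)
        (cong (sys (C (H e))) (trans (cong (_∷ʳ sd d) (cs-carries δL δR)) (sym (qword-∷ʳ δL d δR))))
        (sym (moveR-norm δL d (e ∷ δR))) z<s)
  forward-phase δL d [] c⊥ .[] .(map cd δL) refl | [] =
    reading (map cs (map cd δL) ++ [ sd d ]) s$
      (cong (sys (C Fwd⊥)) (sym (++-assoc (map cs (map cd δL)) [ sd d ] [ s$ ])))
      (fwd-reads c⊥) (fwd-receives-$ c⊥)
      (inert-to (forward-end δL d) (cong (λ t → sys (fwd-end c⊥) (t ++ [ sd d ])) (sym (map-∘ {g = cs} {f = cd} δL)))
        refl ≤-refl)
  forward-phase δL d δR c .(U ∷ʳ y) Z eq | U ∷ʳ′ y =
    reading (map cs Z ++ sd d ∷ s$ ∷ map cs U) (cs y)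
      (cong (sys (C (fname c))) (snoc-map (map cs Z) (sd d ∷ s$ ∷ []) cs U y))
      (fwd-reads c) (fwd-receives c y apart)
      (inert-to (forward-emit δL d δR c y U Z eq') refl refl
        (≤-reflexive (cong (suc ∘ suc) (sym (weight-∷ʳ U y)))))
    where
      eq' : carries δL δR ≡ U ++ y ∷ c ∷ Z
      eq' = trans eq (∷ʳ-++ U y (c ∷ Z))

      apart : c ≡ c⊥ → y ≡ c⊥ → ⊥
      apart refl refl = single-separator δL δR U Z eq'

  phase : ∀ c → IsIdle c ⊎ Phase c
  phase (idle δL d δR) = inj₁ (is-idle δL d δR)
  phase (left₁ δL d δR) = inj₂ (writing refl left-writes (inert-to (left₂ δL d δR) refl refl ≤-refl))
  phase (left₂ δL d δR) = inj₂ (left-phase δL d δR)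
  phase (left-end₁ d δR) = inj₂ (writing refl (prefix-writes s$) (inert-to (left-end₂ d δR) refl refl ≤-refl))
  phase (left-end₂ d δR) = inj₂ (writing refl (prefix-writes s⊥)
    (inert-to (back (d ∷ δR) []) refl (cong (tape [] □) (++-identityʳ (d ∷ δR))) ≤-refl))
  phase (back α β) = inj₂ (back-phase α β)
  phase (back-emit α e β) = inj₂ (writing refl (prefix-writes (sd e)) (inert-to (back α (e ∷ β)) refl refl ≤-refl))
  phase (right₁ δL d δR) = inj₂ (writing refl right-writes (inert-to (right₂ δL d δR) refl refl ≤-refl))
  phase (right₂ δL d δR) = inj₂ (writing refl (prefix-writes (sd d)) (inert-to (right₃ δL d δR) refl refl ≤-refl))
  phase (right₃ δL d δR) = inj₂ (right-phase δL d δR)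
  phase (forward δL d δR c U Z eq) = inj₂ (forward-phase δL d δR c U Z eq)
  phase (forward-emit δL d δR c y U Z eq) =
    inj₂ (writing refl (prefix-writes (cs c)) (inert-to (forward δL d δR y U (c ∷ Z) eq) refl refl ≤-refl))
  phase (forward-end δL d) = inj₂ (writing refl (prefix-writes s⊥)
    (inert-to (idle (δL ∷ʳ d) □ []) (cong (λ t → sys (C (H □)) (s⊥ ∷ t)) (sym (map-++ sd δL [ d ])))
      (sym (moveR-norm δL d [])) z<s))

  refinement : IsRefinement
  refinement = record
    { visible-abs   = visible-tape
    ; visible-emb   = visible-system
    ; visible-not-τ = λ ()
    ; abs-steps     = λ { (is-idle _ _ _) h → tape-steps h }
    ; emb-steps     = λ {c} h → steps c h
    ; progress      = λ c → map₂ phase-progress (phase c)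
    ; abs-final     = λ _ → tape-final _
    ; emb-final     = λ { (is-idle _ _ _) _ → par idle-final (queue-final _) }
    }
    where
      steps : ∀ c {a q} → E ⊢ embed c ⟶[ a ] q → (∃[ c' ] (Visible c a c' × q ≡ embed c')) ⊎ (a ≡ τ × Inert c q)
      steps c h with phase c
      ... | inj₁ (is-idle _ _ _) = inj₁ (idle-visible h)
      ... | inj₂ ph = inj₂ (phase-steps ph h)

theorem4 : (k n : ℕ) (d : DB n) (δL δR : List (DB n)) →
    𝒯 (E-T∞ {A = Fin k}) (var (tape δL d δR)) ≈Δ 𝒯 (E-TQ {A = Fin k}) (system d δL δR)
theorem4 k n d δL δR = bisimilar refinement (idle δL d δR)
  where open Machine {Fin k} {n}
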